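{- For all $n\geq2$, $$g(n)-pr\,g(n-1)=\sum_{i=1}^ng(n|ii)+r(q-p)\sum_{i=1}^{n-1}g(n-1|ii).$$
   Context: A Stirling permutation of order $n$ is a permutation $\sigma=\sigma_1\cdots\sigma_{2n}$ of the multiset $\{1,1,2,2,\ldots,n,n\}$ such that, for each $i\in[n]$, every entry between the two occurrences of $i$ is greater than $i$; $\mathcal{Q}_n$ is the set of these. For $\sigma\in\mathcal{Q}_n$: $\mathrm{des}(\sigma)$, $\mathrm{asc}(\sigma)$, $\mathrm{plat}(\sigma)$ are the numbers of $i\in\{1,\dots,2n-1\}$ with $\sigma_i>\sigma_{i+1}$, $\sigma_i<\sigma_{i+1}$, $\sigma_i=\sigma_{i+1}$ respectively. $\mathcal{Q}_n(132)$ is the set of $\sigma\in\mathcal{Q}_n$ with no subsequence $\sigma_{i_1}\sigma_{i_2}\sigma_{i_3}$ ($i_1<i_2<i_3$) satisfying $\sigma_{i_1}<\sigma_{i_3}<\sigma_{i_2}$. Define $g(n)=\sum_{\sigma\in\mathcal{Q}_n(132)}p^{\mathrm{plat}(\sigma)}q^{\mathrm{des}(\sigma)}r^{\mathrm{asc}(\sigma)}$, and for a word $i_1\cdots i_s$, $g(n|i_1\cdots i_s)$ is the same sum restricted to those $\sigma\in\mathcal{Q}_n(132)$ whose first $s$ letters are $i_1,\dots,i_s$ (an empty sum being $0$). -}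

module Defs where

open import Data.Bool using (Bool; true; false; _∧_; _∨_; not; if_then_else_)
open import Data.Nat using (ℕ; zero; suc; _<ᵇ_; _≡ᵇ_)
import Data.Nat as ℕ
open import Data.List using (List; []; _∷_; map; foldr; concatMap; length)
open import Data.Bool.ListAction using (all; any)
open import Data.Product using (_×_; _,_)
open import Data.Integer using (ℤ; _+_; _*_; _^_) renaming (0ℤ to z0)

-- Words are lists of positive naturals (letters 1..n).

range : ℕ → List ℕ
range zero = []
range (suc n) = foldr _∷_ (suc n ∷ []) (range n)

words : ℕ → ℕ → List (List ℕ)
words n zero = [] ∷ []
words n (suc k) = concatMap (λ a → map (a ∷_) (words n k)) (range n)

count : ℕ → List ℕ → ℕ
count i [] = 0
count i (x ∷ xs) = if x ≡ᵇ i then suc (count i xs) else count i xs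

isMultisetPerm : ℕ → List ℕ → Bool
isMultisetPerm n w =
  (length w ≡ᵇ 2 ℕ.* n) ∧ all (λ i → count i w ≡ᵇ 2) (range n)

pairs : List ℕ → List (ℕ × ℕ)
pairs [] = []
pairs (y ∷ ys) = map (y ,_) ys Data.List.++ pairs ys

triples : List ℕ → List (ℕ × ℕ × ℕ)
triples [] = []
triples (x ∷ xs) = map (λ { (y , z) → (x , y , z) }) (pairs xs) Data.List.++ triples xs

stirlingCond : List ℕ → Bool
stirlingCond w = all (λ { (x , y , z) → not (x ≡ᵇ z) ∨ (x <ᵇ y) }) (triples w)

isStirling : ℕ → List ℕ → Bool
isStirling n w = isMultisetPerm n w ∧ stirlingCond w

contains132 : List ℕ → Bool
contains132 w = any (λ { (x , y , z) → (x <ᵇ z) ∧ (z <ᵇ y) }) (triples w)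

inQ132 : ℕ → List ℕ → Bool
inQ132 n w = isStirling n w ∧ not (contains132 w)

des asc plat : List ℕ → ℕ
des (x ∷ y ∷ w) = (if y <ᵇ x then 1 else 0) ℕ.+ des (y ∷ w)
des _ = 0
asc (x ∷ y ∷ w) = (if x <ᵇ y then 1 else 0) ℕ.+ asc (y ∷ w)
asc _ = 0
plat (x ∷ y ∷ w) = (if x ≡ᵇ y then 1 else 0) ℕ.+ plat (y ∷ w)
plat _ = 0

weight : ℤ → ℤ → ℤ → List ℕ → ℤ
weight p q r σ = (p ^ plat σ) * (q ^ des σ) * (r ^ asc σ)

isPrefix : List ℕ → List ℕ → Bool
isPrefix [] _ = true
isPrefix (a ∷ u) [] = false
isPrefix (a ∷ u) (b ∷ w) = (a ≡ᵇ b) ∧ isPrefix u w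

sumℤ : List ℤ → ℤ
sumℤ = foldr _+_ z0

gPre : ℤ → ℤ → ℤ → ℕ → List ℕ → ℤ
gPre p q r n u =
  sumℤ (map (λ σ → if inQ132 n σ ∧ isPrefix u σ then weight p q r σ else z0)
            (words n (2 ℕ.* n)))

g : ℤ → ℤ → ℤ → ℕ → ℤ
g p q r n = gPre p q r n []

sumFrom1 : ℕ → (ℕ → ℤ) → ℤ
sumFrom1 m f = sumℤ (map f (range m))

-- Split Q_n(132) according to whether σ starts with a plateau σ₁ = σ₂; those σ contribute Σᵢ g(n|ii).
-- Otherwise σ = x y c …, and the second copy of x lies to the right of y, so x < y by the Stirling
-- condition; avoiding 132 then forces y = c = x+1 (any other value would leave x+1 to the right,
-- below y or c). Deleting this plateau and lowering the letters above x+1 is a bijection onto the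
-- τ ∈ Q_{n-1}(132) starting with x < n, and weight σ = r · weight τ · (q if τ starts with a plateau,
-- else p): the ascent x(x+1) and the plateau (x+1)(x+1) are new, and the step leaving the plateau is
-- a descent exactly where τ had a plateau. Summing, g(n) = Σᵢ g(n|ii) + r (p g(n-1) + (q-p) Σᵢ g(n-1|ii)).
module Submission where

open import Defs
open import Algebra.Bundles using (CommutativeMonoid)
open import Algebra.Structures using (IsCommutativeMonoid)
open import Level using (0ℓ)
open import Data.Bool using (Bool; T; true; false; _∧_; _∨_; not; if_then_else_)
import Data.Bool.Properties as Bool
open import Data.Bool.ListAction using (all; any)
open import Data.Empty using (⊥; ⊥-elim)
open import Data.Integer using (ℤ; _+_; _-_; _*_; _^_; 0ℤ; 1ℤ)
import Data.Integer.Properties as ℤ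
open import Data.Integer.Tactic.RingSolver using (solve-∀)
open import Data.List using (List; []; _∷_; _++_; map; concatMap; length)
import Data.List.Properties as List
open import Data.List.Membership.Propositional using (_∈_; _∉_; lose)
open import Data.List.Membership.Propositional.Properties using (∈-++⁺ˡ; ∈-++⁺ʳ; ∈-++⁻; ∈-map⁺; ∈-map⁻)
open import Data.List.Relation.Binary.Permutation.Propositional using (_↭_; ↭-refl; ↭-sym; ↭⇒↭ₛ; module PermutationReasoning)
open import Data.List.Relation.Binary.Permutation.Propositional.Properties using (map⁺; ++⁺ʳ; ∷↭∷ʳ; ∈-resp-↭)
open import Data.List.Relation.Binary.Permutation.Setoid.Properties using (foldr-commMonoid)
open import Data.List.Relation.Unary.Any using (here; there)
import Data.List.Relation.Unary.All as ListAll
open import Data.List.Relation.Unary.All.Properties using (all⁺)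
open import Data.List.Relation.Unary.Any.Properties using (any⁺)
open import Data.List.Relation.Binary.Sublist.Propositional using (_⊆_; _∷_; _∷ʳ_; from∈; to∈)
open import Data.Nat as ℕ using (ℕ; zero; suc; _≤_; _<_; _∸_; z≤n; s≤s; _<ᵇ_; _≡ᵇ_; _≟_; _<?_)
import Data.Nat.Properties as ℕ
open import Data.Product using (_×_; _,_; proj₁; proj₂)
import Data.Product as Prod
open import Data.Sum using (inj₁; inj₂)
open import Function using (_∘_; Equivalence)
open import Relation.Binary.PropositionalEquality
open import Relation.Nullary using (¬_; yes; no)
open import Relation.Binary.Definitions using (tri<; tri≈; tri>)
open import Relation.Nullary.Decidable using (dec-true; dec-false)

≡ᵇ-refl : ∀ n → (n ≡ᵇ n) ≡ true
≡ᵇ-refl n = dec-true (n ≟ n) refl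

≡ᵇ-≢ : ∀ {m n} → m ≢ n → (m ≡ᵇ n) ≡ false
≡ᵇ-≢ {m} {n} = dec-false (m ≟ n)

<ᵇ-< : ∀ {m n} → m < n → (m <ᵇ n) ≡ true
<ᵇ-< {m} {n} = dec-true (m <? n)

<ᵇ-≮ : ∀ {m n} → ¬ m < n → (m <ᵇ n) ≡ false
<ᵇ-≮ {m} {n} = dec-false (m <? n)

<ᵇ-asym : ∀ x z → ((x <ᵇ z) ∧ (z <ᵇ x)) ≡ false
<ᵇ-asym x z with x <? z
... | yes x<z = trans (cong (_∧ (z <ᵇ x)) (<ᵇ-< x<z)) (<ᵇ-≮ (ℕ.<-asym x<z))
... | no x≮z = cong (_∧ (z <ᵇ x)) (<ᵇ-≮ x≮z)

<ᵇ-between-suc : ∀ a z → ((a <ᵇ z) ∧ (z <ᵇ suc a)) ≡ false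
<ᵇ-between-suc a z with a <? z
... | yes a<z = trans (cong (_∧ (z <ᵇ suc a)) (<ᵇ-< a<z)) (<ᵇ-≮ (ℕ.<⇒≱ a<z ∘ ℕ.≤-pred))
... | no a≮z = cong (_∧ (z <ᵇ suc a)) (<ᵇ-≮ a≮z)

suc-<ᵇ : ∀ {a z} → z ≢ suc a → (suc a <ᵇ z) ≡ (a <ᵇ z)
suc-<ᵇ {a} {z} z≢1+a with a <? z
... | yes a<z = trans (<ᵇ-< (ℕ.≤∧≢⇒< a<z (z≢1+a ∘ sym))) (sym (<ᵇ-< a<z))
... | no a≮z = trans (<ᵇ-≮ (a≮z ∘ ℕ.<-trans (ℕ.n<1+n a))) (sym (<ᵇ-≮ a≮z))

∉⇒≢ : ∀ {x y : ℕ} {w} → x ∉ w → y ∈ w → x ≢ y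
∉⇒≢ x∉w y∈w refl = x∉w y∈w

-- The ℕ analogue of Data.Fin.punchIn: making room for a new letter i shifts the letters ≥ i up by one.
punchIn : ℕ → ℕ → ℕ
punchIn i y = if y <ᵇ i then y else suc y

punchIn-< : ∀ {i y} → y < i → punchIn i y ≡ y
punchIn-< y<i rewrite <ᵇ-< y<i = refl

punchIn-≥ : ∀ {i y} → i ≤ y → punchIn i y ≡ suc y
punchIn-≥ i≤y rewrite <ᵇ-≮ (ℕ.≤⇒≯ i≤y) = refl

punchIn-≢ : ∀ i y → punchIn i y ≢ i
punchIn-≢ i y with y <? i
... | yes y<i = ℕ.<⇒≢ (subst (_< i) (sym (punchIn-< y<i)) y<i)
... | no y≮i = ℕ.>⇒≢ (subst (i <_) (sym (punchIn-≥ (ℕ.≮⇒≥ y≮i))) (s≤s (ℕ.≮⇒≥ y≮i)))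

punchIn-mono-< : ∀ i {x y} → x < y → punchIn i x < punchIn i y
punchIn-mono-< i {x} {y} x<y with x <? i | y <? i
... | yes x<i | yes y<i rewrite punchIn-< x<i | punchIn-< y<i = x<y
... | yes x<i | no y≮i rewrite punchIn-< x<i | punchIn-≥ (ℕ.≮⇒≥ y≮i) = ℕ.m≤n⇒m≤1+n x<y
... | no x≮i | yes y<i = ⊥-elim (x≮i (ℕ.<-trans x<y y<i))
... | no x≮i | no y≮i rewrite punchIn-≥ (ℕ.≮⇒≥ x≮i) | punchIn-≥ (ℕ.≮⇒≥ y≮i) = s≤s x<y

range-suc : ∀ n → range (suc n) ≡ range n ++ suc n ∷ []
range-suc n = sym (List.++-is-foldr (range n) _)

∈-range⁻ : ∀ {x} n → x ∈ range n → 0 < x × x ≤ n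
∈-range⁻ (suc n) x∈ rewrite range-suc n with ∈-++⁻ (range n) x∈
... | inj₁ x∈′ = let (0<x , x≤n) = ∈-range⁻ n x∈′ in 0<x , ℕ.m≤n⇒m≤1+n x≤n
... | inj₂ (here refl) = s≤s z≤n , ℕ.≤-refl

∈-range⁺ : ∀ {x} n → 0 < x → x ≤ n → x ∈ range n
∈-range⁺ zero 0<x x≤0 = ⊥-elim (ℕ.<⇒≱ 0<x x≤0)
∈-range⁺ {x} (suc n) 0<x x≤1+n rewrite range-suc n with x ≟ suc n
... | yes refl = ∈-++⁺ʳ (range n) (here refl)
... | no x≢1+n = ∈-++⁺ˡ (∈-range⁺ n 0<x (ℕ.≤-pred (ℕ.≤∧≢⇒< x≤1+n x≢1+n)))

range-punchIn : ∀ {i} m → 0 < i → i ≤ suc m → range (suc m) ↭ i ∷ map (punchIn i) (range m)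
range-punchIn zero (s≤s z≤n) (s≤s z≤n) = ↭-refl
range-punchIn {i} (suc m) 0<i i≤2+m with i ≟ suc (suc m)
... | yes refl = begin
  range (suc (suc m))                     ≡⟨ range-suc (suc m) ⟩
  range (suc m) ++ suc (suc m) ∷ []       ↭⟨ ↭-sym (∷↭∷ʳ _ (range (suc m))) ⟩
  suc (suc m) ∷ range (suc m)             ≡⟨ cong (suc (suc m) ∷_) (sym (List.map-id-local (ListAll.tabulate below))) ⟩
  suc (suc m) ∷ map (punchIn i) (range (suc m)) ∎
  where
  open PermutationReasoning
  below : ∀ {y} → y ∈ range (suc m) → punchIn i y ≡ y
  below y∈ = punchIn-< (s≤s (proj₂ (∈-range⁻ (suc m) y∈)))
... | no i≢2+m = begin
  range (suc (suc m))                                       ≡⟨ range-suc (suc m) ⟩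
  range (suc m) ++ suc (suc m) ∷ []                         ↭⟨ ++⁺ʳ _ (range-punchIn m 0<i i≤1+m) ⟩
  i ∷ map (punchIn i) (range m) ++ suc (suc m) ∷ []         ≡⟨ cong (λ y → i ∷ map (punchIn i) (range m) ++ y ∷ []) (sym (punchIn-≥ i≤1+m)) ⟩
  i ∷ map (punchIn i) (range m) ++ punchIn i (suc m) ∷ []   ≡⟨ cong (i ∷_) (sym (List.map-++ (punchIn i) (range m) _)) ⟩
  i ∷ map (punchIn i) (range m ++ suc m ∷ [])               ≡⟨ cong (λ xs → i ∷ map (punchIn i) xs) (sym (range-suc m)) ⟩
  i ∷ map (punchIn i) (range (suc m))                       ∎
  where
  open PermutationReasoning
  i≤1+m = ℕ.≤-pred (ℕ.≤∧≢⇒< i≤2+m i≢2+m)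

module BigOperator {A : Set} {_∙_ : A → A → A} {ε : A}
                   (isCommutativeMonoid : IsCommutativeMonoid _≡_ _∙_ ε) where

  private
    commutativeMonoid : CommutativeMonoid 0ℓ 0ℓ
    commutativeMonoid = record { isCommutativeMonoid = isCommutativeMonoid }

  open CommutativeMonoid commutativeMonoid using (assoc; comm; identityˡ; identityʳ; commutativeSemigroup)
  open import Algebra.Properties.CommutativeSemigroup commutativeSemigroup using (interchange)
  open ≡-Reasoning

  ⨁ : {X : Set} → List X → (X → A) → A
  ⨁ xs f = Data.List.foldr _∙_ ε (map f xs)

  module _ {X : Set} where

    ⨁-++ : ∀ (xs ys : List X) f → ⨁ (xs ++ ys) f ≡ ⨁ xs f ∙ ⨁ ys f
    ⨁-++ [] ys f = sym (identityˡ _)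
    ⨁-++ (x ∷ xs) ys f = trans (cong (f x ∙_) (⨁-++ xs ys f)) (sym (assoc _ _ _))

    ⨁-cong : ∀ (xs : List X) {f h} → (∀ x → x ∈ xs → f x ≡ h x) → ⨁ xs f ≡ ⨁ xs h
    ⨁-cong [] eq = refl
    ⨁-cong (x ∷ xs) eq = cong₂ _∙_ (eq x (here refl)) (⨁-cong xs (λ y y∈ → eq y (there y∈)))

    ⨁-ε : ∀ (xs : List X) {f} → (∀ x → x ∈ xs → f x ≡ ε) → ⨁ xs f ≡ ε
    ⨁-ε [] eq = refl
    ⨁-ε (x ∷ xs) eq =
      trans (cong₂ _∙_ (eq x (here refl)) (⨁-ε xs (λ y y∈ → eq y (there y∈)))) (identityˡ ε)

    ⨁-∙ : ∀ (xs : List X) f h → ⨁ xs (λ x → f x ∙ h x) ≡ ⨁ xs f ∙ ⨁ xs h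
    ⨁-∙ [] f h = sym (identityˡ ε)
    ⨁-∙ (x ∷ xs) f h = begin
      (f x ∙ h x) ∙ ⨁ xs (λ x → f x ∙ h x) ≡⟨ cong ((f x ∙ h x) ∙_) (⨁-∙ xs f h) ⟩
      (f x ∙ h x) ∙ (⨁ xs f ∙ ⨁ xs h)      ≡⟨ interchange (f x) (h x) _ _ ⟩
      (f x ∙ ⨁ xs f) ∙ (h x ∙ ⨁ xs h)      ∎

    ⨁-↭ : ∀ {xs ys : List X} f → xs ↭ ys → ⨁ xs f ≡ ⨁ ys f
    ⨁-↭ f p = foldr-commMonoid (setoid A) isCommutativeMonoid (↭⇒↭ₛ (map⁺ f p))

    ⨁-homo : ∀ (h : A → A) → h ε ≡ ε → (∀ a b → h (a ∙ b) ≡ h a ∙ h b) →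
             ∀ (xs : List X) f → ⨁ xs (h ∘ f) ≡ h (⨁ xs f)
    ⨁-homo h h-ε h-∙ [] f = sym h-ε
    ⨁-homo h h-ε h-∙ (x ∷ xs) f = trans (cong (h (f x) ∙_) (⨁-homo h h-ε h-∙ xs f)) (sym (h-∙ _ _))

  module _ {X Y : Set} where

    ⨁-map : ∀ (g : X → Y) xs f → ⨁ (map g xs) f ≡ ⨁ xs (f ∘ g)
    ⨁-map g xs f = cong (Data.List.foldr _∙_ ε) (sym (List.map-∘ xs))

    ⨁-concatMap : ∀ (g : X → List Y) xs f → ⨁ (concatMap g xs) f ≡ ⨁ xs (λ x → ⨁ (g x) f)
    ⨁-concatMap g [] f = refl
    ⨁-concatMap g (x ∷ xs) f = trans (⨁-++ (g x) (concatMap g xs) f) (cong (⨁ (g x) f ∙_) (⨁-concatMap g xs f))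

    ⨁-comm : ∀ (xs : List X) (ys : List Y) (f : X → Y → A) → ⨁ xs (λ x → ⨁ ys (f x)) ≡ ⨁ ys (λ y → ⨁ xs (λ x → f x y))
    ⨁-comm [] ys f = sym (⨁-ε ys (λ _ _ → refl))
    ⨁-comm (x ∷ xs) ys f = trans (cong (⨁ ys (f x) ∙_) (⨁-comm xs ys f))
                                 (sym (⨁-∙ ys (f x) (λ y → ⨁ xs (λ x′ → f x′ y))))

  ⨁-range-punchIn : ∀ {i} m f → 0 < i → i ≤ suc m →
                    ⨁ (range (suc m)) f ≡ f i ∙ ⨁ (range m) (f ∘ punchIn i)
  ⨁-range-punchIn {i} m f 0<i i≤1+m =
    trans (⨁-↭ f (range-punchIn m 0<i i≤1+m)) (cong (f i ∙_) (⨁-map (punchIn i) (range m) f))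

  ⨁-range-single : ∀ {x} n f → x ∈ range n → (∀ i → i ∈ range n → i ≢ x → f i ≡ ε) →
                   ⨁ (range n) f ≡ f x
  ⨁-range-single {x} (suc m) f x∈ others = begin
    ⨁ (range (suc m)) f                         ≡⟨ ⨁-range-punchIn m f 0<x x≤1+m ⟩
    f x ∙ ⨁ (range m) (f ∘ punchIn x)           ≡⟨ cong (f x ∙_) (⨁-ε (range m) vanish) ⟩
    f x ∙ ε                                     ≡⟨ identityʳ (f x) ⟩
    f x                                         ∎
    where
    0<x = proj₁ (∈-range⁻ (suc m) x∈)
    x≤1+m = proj₂ (∈-range⁻ (suc m) x∈)
    vanish : ∀ y → y ∈ range m → f (punchIn x y) ≡ ε
    vanish y y∈ = others (punchIn x y)
      (∈-resp-↭ (↭-sym (range-punchIn m 0<x x≤1+m)) (there (∈-map⁺ (punchIn x) y∈)))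
      (punchIn-≢ x y)

  ⨁-words-suc : ∀ n k f →
                ⨁ (words n (suc k)) f ≡ ⨁ (range n) (λ x → ⨁ (words n k) (λ w → f (x ∷ w)))
  ⨁-words-suc n k f = trans (⨁-concatMap (λ a → map (a ∷_) (words n k)) (range n) f)
                            (⨁-cong (range n) (λ x _ → ⨁-map (x ∷_) (words n k) f))

  ⨁-words-punchIn : ∀ {i} m L h → 0 < i → i ≤ suc m → (∀ w → i ∈ w → h w ≡ ε) →
                    ⨁ (words (suc m) L) h ≡ ⨁ (words m L) (h ∘ map (punchIn i))
  ⨁-words-punchIn m zero h 0<i i≤1+m vanish = refl
  ⨁-words-punchIn {i} m (suc L) h 0<i i≤1+m vanish = begin
    ⨁ (words (suc m) (suc L)) h
      ≡⟨ ⨁-words-suc (suc m) L h ⟩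
    ⨁ (range (suc m)) (λ x → ⨁ (words (suc m) L) (λ w → h (x ∷ w)))
      ≡⟨ ⨁-cong (range (suc m)) (λ x _ → ⨁-words-punchIn m L (λ w → h (x ∷ w)) 0<i i≤1+m
                                            (λ w i∈w → vanish (x ∷ w) (there i∈w))) ⟩
    ⨁ (range (suc m)) hd
      ≡⟨ ⨁-range-punchIn m hd 0<i i≤1+m ⟩
    hd i ∙ ⨁ (range m) (hd ∘ punchIn i)
      ≡⟨ cong (_∙ ⨁ (range m) (hd ∘ punchIn i)) (⨁-ε (words m L) (λ v _ → vanish _ (here refl))) ⟩
    ε ∙ ⨁ (range m) (hd ∘ punchIn i)
      ≡⟨ identityˡ _ ⟩
    ⨁ (range m) (hd ∘ punchIn i)
      ≡⟨ sym (⨁-words-suc m L (h ∘ map (punchIn i))) ⟩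
    ⨁ (words m (suc L)) (h ∘ map (punchIn i)) ∎
    where
    hd : ℕ → A
    hd x = ⨁ (words m L) (λ v → h (x ∷ map (punchIn i) v))

  ⨁-pairs-∷ : ∀ y w (P : ℕ × ℕ → A) → ⨁ (pairs (y ∷ w)) P ≡ ⨁ w (λ z → P (y , z)) ∙ ⨁ (pairs w) P
  ⨁-pairs-∷ y w P = trans (⨁-++ (map (y ,_) w) (pairs w) P) (cong (_∙ ⨁ (pairs w) P) (⨁-map (y ,_) w P))

  ⨁-triples-∷ : ∀ x w (C : ℕ × ℕ × ℕ → A) →
                ⨁ (triples (x ∷ w)) C ≡ ⨁ (pairs w) (λ (y , z) → C (x , y , z)) ∙ ⨁ (triples w) C
  ⨁-triples-∷ x w C = trans (⨁-++ (map _ (pairs w)) (triples w) C) (cong (_∙ ⨁ (triples w) C) (⨁-map _ (pairs w) C))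

  -- Every triple through an inserted letter b is neutral, or absorbed by the matching triple through a.
  ⨁-triples-insertPlateau : ∀ a b V (C : ℕ × ℕ × ℕ → A) →
    C (a , b , b) ≡ ε →
    (∀ z → z ∈ V → C (a , b , z) ≡ ε) →
    (∀ z → z ∈ V → C (b , b , z) ≡ ε) →
    (∀ y z → (y , z) ∈ pairs V → C (b , y , z) ∙ C (a , y , z) ≡ C (a , y , z)) →
    ⨁ (triples (a ∷ b ∷ b ∷ V)) C ≡ ⨁ (triples (a ∷ V)) C
  ⨁-triples-insertPlateau a b V C abb abz bbz absorb = begin
    ⨁ (triples (a ∷ b ∷ b ∷ V)) C                          ≡⟨ ⨁-triples-∷ a (b ∷ b ∷ V) C ⟩
    ⨁ (pairs (b ∷ b ∷ V)) (through a) ∙ ⨁ (triples (b ∷ b ∷ V)) C ≡⟨ cong₂ _∙_ pairs-through-a triples-from-b ⟩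
    Pa ∙ (Pb ∙ (Pb ∙ Rest))                                 ≡⟨ trans (absorbs (Pb ∙ Rest)) (absorbs Rest) ⟩
    Pa ∙ Rest                                               ≡⟨ sym (⨁-triples-∷ a V C) ⟩
    ⨁ (triples (a ∷ V)) C                                  ∎
    where
    through : ℕ → ℕ × ℕ → A
    through x (y , z) = C (x , y , z)
    Pa = ⨁ (pairs V) (through a)
    Pb = ⨁ (pairs V) (through b)
    Rest = ⨁ (triples V) C

    pairs-through-a : ⨁ (pairs (b ∷ b ∷ V)) (through a) ≡ Pa
    pairs-through-a = begin
      ⨁ (pairs (b ∷ b ∷ V)) (through a)                            ≡⟨ ⨁-pairs-∷ b (b ∷ V) (through a) ⟩
      (C (a , b , b) ∙ ⨁ V (through a ∘ (b ,_))) ∙ ⨁ (pairs (b ∷ V)) (through a)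
        ≡⟨ cong₂ (λ s t → (s ∙ t) ∙ ⨁ (pairs (b ∷ V)) (through a)) abb (⨁-ε V abz) ⟩
      (ε ∙ ε) ∙ ⨁ (pairs (b ∷ V)) (through a)                      ≡⟨ trans (cong (_∙ ⨁ (pairs (b ∷ V)) (through a)) (identityˡ ε)) (identityˡ _) ⟩
      ⨁ (pairs (b ∷ V)) (through a)                                ≡⟨ ⨁-pairs-∷ b V (through a) ⟩
      ⨁ V (through a ∘ (b ,_)) ∙ Pa                                ≡⟨ cong (_∙ Pa) (⨁-ε V abz) ⟩
      ε ∙ Pa                                                        ≡⟨ identityˡ Pa ⟩
      Pa                                                            ∎

    triples-from-b : ⨁ (triples (b ∷ b ∷ V)) C ≡ Pb ∙ (Pb ∙ Rest)
    triples-from-b = begin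
      ⨁ (triples (b ∷ b ∷ V)) C                                    ≡⟨ ⨁-triples-∷ b (b ∷ V) C ⟩
      ⨁ (pairs (b ∷ V)) (through b) ∙ ⨁ (triples (b ∷ V)) C        ≡⟨ cong₂ _∙_ (⨁-pairs-∷ b V (through b)) (⨁-triples-∷ b V C) ⟩
      (⨁ V (through b ∘ (b ,_)) ∙ Pb) ∙ (Pb ∙ Rest)                ≡⟨ cong (λ s → (s ∙ Pb) ∙ (Pb ∙ Rest)) (⨁-ε V bbz) ⟩
      (ε ∙ Pb) ∙ (Pb ∙ Rest)                                        ≡⟨ cong (_∙ (Pb ∙ Rest)) (identityˡ Pb) ⟩
      Pb ∙ (Pb ∙ Rest)                                              ∎

    absorbs : ∀ t → Pa ∙ (Pb ∙ t) ≡ Pa ∙ t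
    absorbs t = begin
      Pa ∙ (Pb ∙ t) ≡⟨ sym (assoc Pa Pb t) ⟩
      (Pa ∙ Pb) ∙ t ≡⟨ cong (_∙ t) (comm Pa Pb) ⟩
      (Pb ∙ Pa) ∙ t ≡⟨ cong (_∙ t) (sym (⨁-∙ (pairs V) (through b) (through a))) ⟩
      ⨁ (pairs V) (λ p → through b p ∙ through a p) ∙ t ≡⟨ cong (_∙ t) (⨁-cong (pairs V) (λ (y , z) → absorb y z)) ⟩
      Pa ∙ t        ∎

-- Over (ℤ, +), ⨁ xs f is sumℤ (map f xs), so sumFrom1 n f is ⨁ (range n) f; over (Bool, ∧) and
-- (Bool, ∨) it is all f xs and any f xs.
open BigOperator ℤ.+-0-isCommutativeMonoid
module All = BigOperator Bool.∧-isCommutativeMonoid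
module Any = BigOperator Bool.∨-isCommutativeMonoid

∈-pairs⁺ : ∀ {y z w} → y ∷ z ∷ [] ⊆ w → (y , z) ∈ pairs w
∈-pairs⁺ (u ∷ʳ τ) = ∈-++⁺ʳ _ (∈-pairs⁺ τ)
∈-pairs⁺ {y} (refl ∷ τ) = ∈-++⁺ˡ (∈-map⁺ (y ,_) (to∈ τ))

∈-triples⁺ : ∀ {x y z w} → x ∷ y ∷ z ∷ [] ⊆ w → (x , y , z) ∈ triples w
∈-triples⁺ (u ∷ʳ τ) = ∈-++⁺ʳ _ (∈-triples⁺ τ)
∈-triples⁺ {x} (refl ∷ τ) = ∈-++⁺ˡ (∈-map⁺ (x ,_) (∈-pairs⁺ τ))

∈-pairs⁻ : ∀ {y z} w → (y , z) ∈ pairs w → z ∈ w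
∈-pairs⁻ (x ∷ w) yz∈ with ∈-++⁻ (map (x ,_) w) yz∈
... | inj₁ yz∈′ with ∈-map⁻ (x ,_) yz∈′
...   | z′ , z′∈ , refl = there z′∈
∈-pairs⁻ (x ∷ w) yz∈ | inj₂ yz∈′ = there (∈-pairs⁻ w yz∈′)

pairs-map : ∀ f w → pairs (map f w) ≡ map (Prod.map f f) (pairs w)
pairs-map f [] = refl
pairs-map f (y ∷ w) = begin
  map (f y ,_) (map f w) ++ pairs (map f w)                  ≡⟨ cong₂ _++_ (sym (List.map-∘ w)) (pairs-map f w) ⟩
  map (Prod.map f f ∘ (y ,_)) w ++ map (Prod.map f f) (pairs w) ≡⟨ cong (_++ map (Prod.map f f) (pairs w)) (List.map-∘ w) ⟩
  map (Prod.map f f) (map (y ,_) w) ++ map (Prod.map f f) (pairs w) ≡⟨ sym (List.map-++ _ (map (y ,_) w) (pairs w)) ⟩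
  map (Prod.map f f) (pairs (y ∷ w))                         ∎
  where open ≡-Reasoning

triples-map : ∀ f w → triples (map f w) ≡ map (Prod.map f (Prod.map f f)) (triples w)
triples-map f [] = refl
triples-map f (x ∷ w) = begin
  map (f x ,_) (pairs (map f w)) ++ triples (map f w)
    ≡⟨ cong₂ _++_ (trans (cong (map (f x ,_)) (pairs-map f w)) (sym (List.map-∘ (pairs w)))) (triples-map f w) ⟩
  map ((f x ,_) ∘ Prod.map f f) (pairs w) ++ map F (triples w)
    ≡⟨ cong (_++ map F (triples w)) (List.map-∘ (pairs w)) ⟩
  map F (map (x ,_) (pairs w)) ++ map F (triples w)
    ≡⟨ sym (List.map-++ F (map (x ,_) (pairs w)) (triples w)) ⟩
  map F (triples (x ∷ w)) ∎
  where
  open ≡-Reasoning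
  F = Prod.map f (Prod.map f f)

count-∷-≡ : ∀ z w → count z (z ∷ w) ≡ suc (count z w)
count-∷-≡ z w rewrite ≡ᵇ-refl z = refl

count-∷-≢ : ∀ {x z} w → x ≢ z → count z (x ∷ w) ≡ count z w
count-∷-≢ w x≢z rewrite ≡ᵇ-≢ x≢z = refl

count-suc⇒∈ : ∀ {z k} w → count z w ≡ suc k → z ∈ w
count-suc⇒∈ {z} (x ∷ w) eq with x ≟ z
... | yes refl = here refl
... | no x≢z = there (count-suc⇒∈ w (trans (sym (count-∷-≢ w x≢z)) eq))

count-∉ : ∀ {x} w → x ∉ w → count x w ≡ 0
count-∉ [] x∉ = refl
count-∉ {x} (y ∷ w) x∉ rewrite ≡ᵇ-≢ (∉⇒≢ x∉ (here refl) ∘ sym) = count-∉ w (x∉ ∘ there)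

count-∷∷-≢ : ∀ {x y} a w → x ≢ y → count y (a ∷ x ∷ x ∷ w) ≡ count y (a ∷ w)
count-∷∷-≢ {x} {y} a w x≢y rewrite ≡ᵇ-≢ x≢y = refl

∈⇒count-pos : ∀ {z} w → z ∈ w → 0 < count z w
∈⇒count-pos {z} (z ∷ w) (here refl) rewrite count-∷-≡ z w = s≤s z≤n
∈⇒count-pos {z} (x ∷ w) (there z∈) with x ≟ z
... | yes refl rewrite count-∷-≡ z w = s≤s z≤n
... | no x≢z rewrite count-∷-≢ w x≢z = ∈⇒count-pos w z∈

-- stirlingCond w and contains132 w unfold to all respectsStirling (triples w) and any is132 (triples w).
respectsStirling : ℕ × ℕ × ℕ → Bool
respectsStirling (x , y , z) = not (x ≡ᵇ z) ∨ (x <ᵇ y)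

is132 : ℕ × ℕ × ℕ → Bool
is132 (x , y , z) = (x <ᵇ z) ∧ (z <ᵇ y)

startsWithPlateau : List ℕ → Bool
startsWithPlateau (x ∷ y ∷ _) = x ≡ᵇ y
startsWithPlateau _ = false

plateauFactor : ℤ → ℤ → List ℕ → ℤ
plateauFactor p q w = if startsWithPlateau w then q else p

module StrictlyMonotone (f : ℕ → ℕ) (f-mono : ∀ {x y} → x < y → f x < f y) where

  f-cancel-< : ∀ {x y} → f x < f y → x < y
  f-cancel-< {x} {y} fx<fy with x <? y
  ... | yes x<y = x<y
  ... | no x≮y with ℕ.m≤n⇒m<n∨m≡n (ℕ.≮⇒≥ x≮y)
  ...   | inj₁ y<x = ⊥-elim (ℕ.<-asym fx<fy (f-mono y<x))
  ...   | inj₂ refl = ⊥-elim (ℕ.<-irrefl refl fx<fy)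

  f-injective : ∀ {x y} → f x ≡ f y → x ≡ y
  f-injective {x} {y} fx≡fy with ℕ.<-cmp x y
  ... | tri< x<y _ _ = ⊥-elim (ℕ.<-irrefl fx≡fy (f-mono x<y))
  ... | tri≈ _ x≡y _ = x≡y
  ... | tri> _ _ y<x = ⊥-elim (ℕ.<-irrefl (sym fx≡fy) (f-mono y<x))

  <ᵇ-preserved : ∀ x y → (f x <ᵇ f y) ≡ (x <ᵇ y)
  <ᵇ-preserved x y with x <? y
  ... | yes x<y = trans (<ᵇ-< (f-mono x<y)) (sym (<ᵇ-< x<y))
  ... | no x≮y = trans (<ᵇ-≮ (x≮y ∘ f-cancel-<)) (sym (<ᵇ-≮ x≮y))

  ≡ᵇ-preserved : ∀ x y → (f x ≡ᵇ f y) ≡ (x ≡ᵇ y)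
  ≡ᵇ-preserved x y with x ≟ y
  ... | yes refl = trans (≡ᵇ-refl (f x)) (sym (≡ᵇ-refl x))
  ... | no x≢y = trans (≡ᵇ-≢ (x≢y ∘ f-injective)) (sym (≡ᵇ-≢ x≢y))

  private
    f³ : ℕ × ℕ × ℕ → ℕ × ℕ × ℕ
    f³ = Prod.map f (Prod.map f f)

  stirlingCond-map : ∀ w → stirlingCond (map f w) ≡ stirlingCond w
  stirlingCond-map w = begin
    all respectsStirling (triples (map f w))        ≡⟨ cong (all respectsStirling) (triples-map f w) ⟩
    all respectsStirling (map f³ (triples w))       ≡⟨ All.⨁-map f³ (triples w) respectsStirling ⟩
    all (respectsStirling ∘ f³) (triples w)         ≡⟨ All.⨁-cong (triples w) (λ (x , y , z) _ →
                                                         cong₂ _∨_ (cong not (≡ᵇ-preserved x z)) (<ᵇ-preserved x y)) ⟩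
    all respectsStirling (triples w)                ∎
    where open ≡-Reasoning

  contains132-map : ∀ w → contains132 (map f w) ≡ contains132 w
  contains132-map w = begin
    any is132 (triples (map f w))        ≡⟨ cong (any is132) (triples-map f w) ⟩
    any is132 (map f³ (triples w))       ≡⟨ Any.⨁-map f³ (triples w) is132 ⟩
    any (is132 ∘ f³) (triples w)         ≡⟨ Any.⨁-cong (triples w) (λ (x , y , z) _ → cong₂ _∧_ (<ᵇ-preserved x z) (<ᵇ-preserved z y)) ⟩
    any is132 (triples w)                ∎
    where open ≡-Reasoning

  count-map : ∀ y w → count (f y) (map f w) ≡ count y w
  count-map y [] = refl
  count-map y (x ∷ w) rewrite ≡ᵇ-preserved x y | count-map y w = refl

  private
    indicator : Bool → ℕ
    indicator b = if b then 1 else 0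

  des-map : ∀ w → des (map f w) ≡ des w
  des-map [] = refl
  des-map (x ∷ []) = refl
  des-map (x ∷ y ∷ w) = cong₂ ℕ._+_ (cong indicator (<ᵇ-preserved y x)) (des-map (y ∷ w))

  asc-map : ∀ w → asc (map f w) ≡ asc w
  asc-map [] = refl
  asc-map (x ∷ []) = refl
  asc-map (x ∷ y ∷ w) = cong₂ ℕ._+_ (cong indicator (<ᵇ-preserved x y)) (asc-map (y ∷ w))

  plat-map : ∀ w → plat (map f w) ≡ plat w
  plat-map [] = refl
  plat-map (x ∷ []) = refl
  plat-map (x ∷ y ∷ w) = cong₂ ℕ._+_ (cong indicator (≡ᵇ-preserved x y)) (plat-map (y ∷ w))

  weight-map : ∀ p q r w → weight p q r (map f w) ≡ weight p q r w
  weight-map p q r w rewrite plat-map w | des-map w | asc-map w = refl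

  startsWithPlateau-map : ∀ w → startsWithPlateau (map f w) ≡ startsWithPlateau w
  startsWithPlateau-map [] = refl
  startsWithPlateau-map (x ∷ []) = refl
  startsWithPlateau-map (x ∷ y ∷ w) = ≡ᵇ-preserved x y

module PunchIn (i : ℕ) = StrictlyMonotone (punchIn i) (punchIn-mono-< i)

punchIn-∉ : ∀ i v → i ∉ map (punchIn i) v
punchIn-∉ i v i∈ with ∈-map⁻ (punchIn i) i∈
... | y , _ , i≡ = punchIn-≢ i y (sym i≡)

module _ (p q r : ℤ) where

  private
    p-out : ∀ s X Y Z → s * X * Y * Z ≡ s * (X * Y * Z)
    p-out = solve-∀
    q-out : ∀ s X Y Z → X * (s * Y) * Z ≡ s * (X * Y * Z)
    q-out = solve-∀
    r-out : ∀ s X Y Z → X * Y * (s * Z) ≡ s * (X * Y * Z)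
    r-out = solve-∀

  weight-plateau : ∀ {x} w → weight p q r (x ∷ x ∷ w) ≡ p * weight p q r (x ∷ w)
  weight-plateau {x} w rewrite ≡ᵇ-refl x | <ᵇ-≮ (ℕ.n≮n x) = p-out p (p ^ plat (x ∷ w)) (q ^ des (x ∷ w)) (r ^ asc (x ∷ w))

  weight-descent : ∀ {x y} w → y < x → weight p q r (x ∷ y ∷ w) ≡ q * weight p q r (y ∷ w)
  weight-descent {x} {y} w y<x
    rewrite ≡ᵇ-≢ (ℕ.>⇒≢ y<x) | <ᵇ-< y<x | <ᵇ-≮ (ℕ.<-asym y<x) = q-out q (p ^ plat (y ∷ w)) (q ^ des (y ∷ w)) (r ^ asc (y ∷ w))

  weight-ascent : ∀ {x y} w → x < y → weight p q r (x ∷ y ∷ w) ≡ r * weight p q r (y ∷ w)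
  weight-ascent {x} {y} w x<y
    rewrite ≡ᵇ-≢ (ℕ.<⇒≢ x<y) | <ᵇ-≮ (ℕ.<-asym x<y) | <ᵇ-< x<y = r-out r (p ^ plat (y ∷ w)) (q ^ des (y ∷ w)) (r ^ asc (y ∷ w))

  -- Raising the first letter from a to a+1 turns a leading plateau into a descent and changes no other step.
  weight-raise-head : ∀ {a} u → suc a ∉ u →
                      p * weight p q r (suc a ∷ u) ≡ weight p q r (a ∷ u) * plateauFactor p q (a ∷ u)
  weight-raise-head [] _ = ℤ.*-comm p 1ℤ
  weight-raise-head {a} (y ∷ u) 1+a∉ with ℕ.<-cmp a y
  ... | tri< a<y _ _
    rewrite weight-ascent u (ℕ.≤∧≢⇒< a<y (∉⇒≢ 1+a∉ (here refl))) | weight-ascent u a<y | ≡ᵇ-≢ (ℕ.<⇒≢ a<y)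
    = ℤ.*-comm p _
  ... | tri≈ _ refl _
    rewrite weight-descent u (ℕ.n<1+n a) | weight-plateau {a} u | ≡ᵇ-refl a
    = swap-outer p q (weight p q r (a ∷ u))
    where
    swap-outer : ∀ s t X → s * (t * X) ≡ (s * X) * t
    swap-outer = solve-∀
  ... | tri> _ _ y<a
    rewrite weight-descent u (ℕ.m≤n⇒m≤1+n y<a) | weight-descent u y<a | ≡ᵇ-≢ (ℕ.>⇒≢ y<a)
    = ℤ.*-comm p _

stirlingCond-insertPlateau : ∀ {a b} V → a < b → b ∉ V →
                             stirlingCond (a ∷ b ∷ b ∷ V) ≡ stirlingCond (a ∷ V)
stirlingCond-insertPlateau {a} {b} V a<b b∉V =
  All.⨁-triples-insertPlateau a b V respectsStirling (a-below-b b) (λ z _ → a-below-b z) bbz absorb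
  where
  a-below-b : ∀ z → respectsStirling (a , b , z) ≡ true
  a-below-b z = trans (cong (not (a ≡ᵇ z) ∨_) (<ᵇ-< a<b)) (Bool.∨-zeroʳ _)
  bbz : ∀ z → z ∈ V → respectsStirling (b , b , z) ≡ true
  bbz z z∈V rewrite ≡ᵇ-≢ (∉⇒≢ b∉V z∈V) = refl
  absorb : ∀ y z → (y , z) ∈ pairs V → respectsStirling (b , y , z) ∧ respectsStirling (a , y , z) ≡ respectsStirling (a , y , z)
  absorb y z yz∈ rewrite ≡ᵇ-≢ (∉⇒≢ b∉V (∈-pairs⁻ V yz∈)) = refl

contains132-insertPlateau : ∀ {a} V → suc a ∉ V → contains132 (a ∷ suc a ∷ suc a ∷ V) ≡ contains132 (a ∷ V)
contains132-insertPlateau {a} V b∉V =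
  Any.⨁-triples-insertPlateau a (suc a) V is132 abb (λ z _ → <ᵇ-between-suc a z) (λ z _ → <ᵇ-asym (suc a) z) absorb
  where
  abb : is132 (a , suc a , suc a) ≡ false
  abb = trans (cong ((a <ᵇ suc a) ∧_) (<ᵇ-≮ (ℕ.n≮n (suc a)))) (Bool.∧-zeroʳ _)
  absorb : ∀ y z → (y , z) ∈ pairs V → is132 (suc a , y , z) ∨ is132 (a , y , z) ≡ is132 (a , y , z)
  absorb y z yz∈ rewrite suc-<ᵇ {a} (∉⇒≢ b∉V (∈-pairs⁻ V yz∈) ∘ sym) = Bool.∨-idem _

module InsertPlateau {a : ℕ} (v : List ℕ) where

  b = suc a
  V = map (punchIn b) v

  b∉V : b ∉ V
  b∉V = punchIn-∉ b v

  a∷V≡ : a ∷ V ≡ map (punchIn b) (a ∷ v)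
  a∷V≡ = cong (_∷ V) (sym (punchIn-< (ℕ.n<1+n a)))

  isMultisetPerm-insertPlateau : ∀ {m} → a ≤ m → isMultisetPerm (suc m) (a ∷ b ∷ b ∷ V) ≡ isMultisetPerm m (a ∷ v)
  isMultisetPerm-insertPlateau {m} a≤m = cong₂ _∧_ length-ok counts-ok
    where
    length-ok : (length (a ∷ b ∷ b ∷ V) ≡ᵇ 2 ℕ.* suc m) ≡ (length (a ∷ v) ≡ᵇ 2 ℕ.* m)
    length-ok = trans (cong (λ l → suc (suc (suc l)) ≡ᵇ 2 ℕ.* suc m) (List.length-map (punchIn b) v))
                      (cong (suc (suc (suc (length v))) ≡ᵇ_) (ℕ.*-suc 2 m))
    countOf : ℕ → Bool
    countOf i = count i (a ∷ b ∷ b ∷ V) ≡ᵇ 2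
    counts-ok : all countOf (range (suc m)) ≡ all (λ i → count i (a ∷ v) ≡ᵇ 2) (range m)
    counts-ok = begin
      all countOf (range (suc m))
        ≡⟨ All.⨁-range-punchIn m countOf (s≤s z≤n) (s≤s a≤m) ⟩
      countOf b ∧ all (countOf ∘ punchIn b) (range m)
        ≡⟨ cong₂ _∧_ count-b (All.⨁-cong (range m) (λ i _ → cong (_≡ᵇ 2) (count-punchIn i))) ⟩
      true ∧ all (λ i → count i (a ∷ v) ≡ᵇ 2) (range m)
        ∎
      where
      open ≡-Reasoning
      count-b : countOf b ≡ true
      count-b rewrite ≡ᵇ-≢ (ℕ.<⇒≢ (ℕ.n<1+n a)) | ≡ᵇ-refl b | count-∉ V b∉V = refl
      count-punchIn : ∀ i → count (punchIn b i) (a ∷ b ∷ b ∷ V) ≡ count i (a ∷ v)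
      count-punchIn i = begin
        count (punchIn b i) (a ∷ b ∷ b ∷ V)           ≡⟨ count-∷∷-≢ a V (punchIn-≢ b i ∘ sym) ⟩
        count (punchIn b i) (a ∷ V)                   ≡⟨ cong (count (punchIn b i)) a∷V≡ ⟩
        count (punchIn b i) (map (punchIn b) (a ∷ v)) ≡⟨ PunchIn.count-map b i (a ∷ v) ⟩
        count i (a ∷ v)                               ∎

  inQ132-insertPlateau : ∀ {m} → a ≤ m → inQ132 (suc m) (a ∷ b ∷ b ∷ V) ≡ inQ132 m (a ∷ v)
  inQ132-insertPlateau a≤m =
    cong₂ (λ s t → s ∧ not t) (cong₂ _∧_ (isMultisetPerm-insertPlateau a≤m) stirling) avoids
    where
    stirling : stirlingCond (a ∷ b ∷ b ∷ V) ≡ stirlingCond (a ∷ v)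
    stirling = trans (stirlingCond-insertPlateau V (ℕ.n<1+n a) b∉V)
                     (trans (cong stirlingCond a∷V≡) (PunchIn.stirlingCond-map b (a ∷ v)))
    avoids : contains132 (a ∷ b ∷ b ∷ V) ≡ contains132 (a ∷ v)
    avoids = trans (contains132-insertPlateau V b∉V)
                   (trans (cong contains132 a∷V≡) (PunchIn.contains132-map b (a ∷ v)))

  weight-insertPlateau : ∀ p q r →
    weight p q r (a ∷ b ∷ b ∷ V) ≡ r * (weight p q r (a ∷ v) * plateauFactor p q (a ∷ v))
  weight-insertPlateau p q r = begin
    weight p q r (a ∷ b ∷ b ∷ V)                           ≡⟨ weight-ascent p q r (b ∷ V) (ℕ.n<1+n a) ⟩
    r * weight p q r (b ∷ b ∷ V)                           ≡⟨ cong (r *_) (weight-plateau p q r V) ⟩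
    r * (p * weight p q r (b ∷ V))                         ≡⟨ cong (r *_) (weight-raise-head p q r V b∉V) ⟩
    r * (weight p q r (a ∷ V) * plateauFactor p q (a ∷ V)) ≡⟨ cong (λ u → r * (weight p q r u * plateauFactor p q u)) a∷V≡ ⟩
    r * (weight p q r (map (punchIn b) (a ∷ v)) * plateauFactor p q (map (punchIn b) (a ∷ v)))
      ≡⟨ cong₂ (λ s t → r * (s * (if t then q else p))) (PunchIn.weight-map b p q r (a ∷ v)) (PunchIn.startsWithPlateau-map b (a ∷ v)) ⟩
    r * (weight p q r (a ∷ v) * plateauFactor p q (a ∷ v)) ∎
    where open ≡-Reasoning

module Q132 {n σ} (σ∈Q : T (inQ132 n σ)) where

  private
    isStirling-σ : T (isStirling n σ)
    isStirling-σ = proj₁ (Equivalence.to Bool.T-∧ σ∈Q)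
    perm : T (isMultisetPerm n σ)
    perm = proj₁ (Equivalence.to Bool.T-∧ isStirling-σ)
    stirling : T (stirlingCond σ)
    stirling = proj₂ (Equivalence.to Bool.T-∧ isStirling-σ)
    no132 : contains132 σ ≡ false
    no132 = Equivalence.to Bool.T-not-≡ (proj₂ (Equivalence.to (Bool.T-∧ {isStirling n σ}) σ∈Q))

  count-two : ∀ {i} → i ∈ range n → count i σ ≡ 2
  count-two {i} i∈ = ℕ.≡ᵇ⇒≡ (count i σ) 2
    (ListAll.lookup (all⁺ (λ i → count i σ ≡ᵇ 2) (range n) (proj₂ (Equivalence.to (Bool.T-∧ {length σ ≡ᵇ 2 ℕ.* n}) perm))) i∈)

  stirling-at : ∀ {x y} → x ∷ y ∷ x ∷ [] ⊆ σ → x < y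
  stirling-at {x} {y} τ with ListAll.lookup (all⁺ respectsStirling (triples σ) stirling) (∈-triples⁺ τ)
  ... | holds rewrite ≡ᵇ-refl x = ℕ.<ᵇ⇒< x y holds

  no-132-at : ∀ {x y z} → x ∷ y ∷ z ∷ [] ⊆ σ → x < z → z < y → ⊥
  no-132-at τ x<z z<y = subst T no132
    (any⁺ is132 (lose (∈-triples⁺ τ) (Equivalence.from Bool.T-∧ (ℕ.<⇒<ᵇ x<z , ℕ.<⇒<ᵇ z<y))))

module _ {n x : ℕ} where

  second-is-successor : ∀ {y c R} → T (inQ132 n (x ∷ y ∷ c ∷ R)) → x ≢ y → x ∈ range n → y ∈ range n → y ≡ suc x
  second-is-successor {y} {c} {R} σ∈Q x≢y x∈ y∈ with y ≟ suc x
  ... | yes y≡1+x = y≡1+x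
  ... | no y≢1+x = ⊥-elim (no-132-at (refl ∷ refl ∷ from∈ 1+x∈rest) (ℕ.n<1+n x) (ℕ.≤∧≢⇒< x<y (y≢1+x ∘ sym)))
    where
    open Q132 {n} {x ∷ y ∷ c ∷ R} σ∈Q
    x∈rest : x ∈ c ∷ R
    x∈rest = count-suc⇒∈ (c ∷ R) (ℕ.suc-injective (begin
      suc (count x (c ∷ R))      ≡⟨ cong suc (sym (count-∷-≢ (c ∷ R) (x≢y ∘ sym))) ⟩
      suc (count x (y ∷ c ∷ R))  ≡⟨ sym (count-∷-≡ x (y ∷ c ∷ R)) ⟩
      count x (x ∷ y ∷ c ∷ R)    ≡⟨ count-two x∈ ⟩
      2                          ∎))
      where open ≡-Reasoning
    x<y : x < y
    x<y = stirling-at (refl ∷ refl ∷ from∈ x∈rest)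
    1+x∈rest : suc x ∈ c ∷ R
    1+x∈rest = count-suc⇒∈ (c ∷ R) (begin
      count (suc x) (c ∷ R)              ≡⟨ sym (count-∷-≢ (c ∷ R) y≢1+x) ⟩
      count (suc x) (y ∷ c ∷ R)          ≡⟨ sym (count-∷-≢ (y ∷ c ∷ R) (ℕ.<⇒≢ (ℕ.n<1+n x))) ⟩
      count (suc x) (x ∷ y ∷ c ∷ R)      ≡⟨ count-two (∈-range⁺ n (s≤s z≤n) (ℕ.≤-trans x<y (proj₂ (∈-range⁻ n y∈)))) ⟩
      2                                  ∎)
      where open ≡-Reasoning

  third-is-successor : ∀ {c R} → T (inQ132 n (x ∷ suc x ∷ c ∷ R)) → suc x ∈ range n → c ≡ suc x
  third-is-successor {c} {R} σ∈Q 1+x∈ with c ≟ suc x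
  ... | yes c≡1+x = c≡1+x
  ... | no c≢1+x = ⊥-elim (no-132-at (refl ∷ suc x ∷ʳ refl ∷ from∈ 1+x∈R) (ℕ.n<1+n x) 1+x<c)
    where
    open Q132 {n} {x ∷ suc x ∷ c ∷ R} σ∈Q
    1+x∈R : suc x ∈ R
    1+x∈R = count-suc⇒∈ R (ℕ.suc-injective (begin
      suc (count (suc x) R)                ≡⟨ cong suc (sym (count-∷-≢ R c≢1+x)) ⟩
      suc (count (suc x) (c ∷ R))          ≡⟨ sym (count-∷-≡ (suc x) (c ∷ R)) ⟩
      count (suc x) (suc x ∷ c ∷ R)        ≡⟨ sym (count-∷-≢ (suc x ∷ c ∷ R) (ℕ.<⇒≢ (ℕ.n<1+n x))) ⟩
      count (suc x) (x ∷ suc x ∷ c ∷ R)    ≡⟨ count-two 1+x∈ ⟩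
      2                                    ∎))
      where open ≡-Reasoning
    1+x<c : suc x < c
    1+x<c = stirling-at (x ∷ʳ (refl ∷ refl ∷ from∈ 1+x∈R))

  ascent-shape : ∀ {y c R} → T (inQ132 n (x ∷ y ∷ c ∷ R)) → x ≢ y → x ∈ range n → y ∈ range n →
                 y ≡ suc x × c ≡ suc x
  ascent-shape {y} {c} {R} σ∈Q x≢y x∈ y∈ with second-is-successor {y} {c} {R} σ∈Q x≢y x∈ y∈
  ... | refl = refl , third-is-successor {c} {R} σ∈Q y∈

module Sums (p q r : ℤ) where

  term : ℕ → List ℕ → ℤ
  term n σ = if inQ132 n σ then weight p q r σ else 0ℤ

  plateauTerm : ℕ → List ℕ → ℤ
  plateauTerm n σ = if inQ132 n σ ∧ startsWithPlateau σ then weight p q r σ else 0ℤ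

  ascentTerm : ℕ → List ℕ → ℤ
  ascentTerm n σ = if inQ132 n σ ∧ not (startsWithPlateau σ) then weight p q r σ else 0ℤ

  -- gPre with the word length 2n turned into a parameter ℓ.
  prefixSum : ℕ → ℕ → List ℕ → ℤ
  prefixSum n ℓ u = ⨁ (words n ℓ) (λ σ → if inQ132 n σ ∧ isPrefix u σ then weight p q r σ else 0ℤ)

  term-split : ∀ n σ → term n σ ≡ plateauTerm n σ + ascentTerm n σ
  term-split n σ with inQ132 n σ | startsWithPlateau σ
  ... | true | true = sym (ℤ.+-identityʳ _)
  ... | true | false = sym (ℤ.+-identityˡ _)
  ... | false | _ = refl

  term-plateauFactor : ∀ n σ → term n σ * plateauFactor p q σ ≡ p * term n σ + (q - p) * plateauTerm n σ
  term-plateauFactor n σ with inQ132 n σ | startsWithPlateau σ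
  ... | true | true = on-plateau p q (weight p q r σ)
    where
    on-plateau : ∀ p q W → W * q ≡ p * W + (q - p) * W
    on-plateau = solve-∀
  ... | true | false = off-plateau p q (weight p q r σ)
    where
    off-plateau : ∀ p q W → W * p ≡ p * W + (q - p) * 0ℤ
    off-plateau = solve-∀
  ... | false | _ = absent p q (plateauFactor p q σ)
    where
    absent : ∀ p q F → 0ℤ * F ≡ p * 0ℤ + (q - p) * 0ℤ
    absent = solve-∀

  plateau-sum : ∀ n k → ⨁ (range n) (λ i → prefixSum n (2 ℕ.+ k) (i ∷ i ∷ []))
                      ≡ ⨁ (words n (2 ℕ.+ k)) (plateauTerm n)
  plateau-sum n k = begin
    ⨁ (range n) (λ i → ⨁ (words n (2 ℕ.+ k)) (starts i))
      ≡⟨ ⨁-comm (range n) (words n (2 ℕ.+ k)) starts ⟩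
    ⨁ (words n (2 ℕ.+ k)) (λ σ → ⨁ (range n) (λ i → starts i σ))
      ≡⟨ ⨁-words-suc n (suc k) _ ⟩
    ⨁ (range n) (λ x → ⨁ (words n (suc k)) (λ w → ⨁ (range n) (λ i → starts i (x ∷ w))))
      ≡⟨ ⨁-cong (range n) (λ x x∈ → trans (⨁-words-suc n k _) (⨁-cong (range n) (λ y _ →
           ⨁-cong (words n k) (λ R _ → ⨁-range-single n (λ i → starts i (x ∷ y ∷ R)) x∈ (others x y R))))) ⟩
    ⨁ (range n) (λ x → ⨁ (range n) (λ y → ⨁ (words n k) (λ R → starts x (x ∷ y ∷ R))))
      ≡⟨ ⨁-cong (range n) (λ x _ → ⨁-cong (range n) (λ y _ → ⨁-cong (words n k) (λ R _ → own x y R))) ⟩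
    ⨁ (range n) (λ x → ⨁ (range n) (λ y → ⨁ (words n k) (λ R → plateauTerm n (x ∷ y ∷ R))))
      ≡⟨ sym (trans (⨁-words-suc n (suc k) _) (⨁-cong (range n) (λ x _ → ⨁-words-suc n k _))) ⟩
    ⨁ (words n (2 ℕ.+ k)) (plateauTerm n) ∎
    where
    open ≡-Reasoning
    starts : ℕ → List ℕ → ℤ
    starts i σ = if inQ132 n σ ∧ isPrefix (i ∷ i ∷ []) σ then weight p q r σ else 0ℤ
    others : ∀ x y R i → i ∈ range n → i ≢ x → starts i (x ∷ y ∷ R) ≡ 0ℤ
    others x y R i _ i≢x rewrite ≡ᵇ-≢ i≢x | Bool.∧-zeroʳ (inQ132 n (x ∷ y ∷ R)) = refl
    own : ∀ x y R → starts x (x ∷ y ∷ R) ≡ plateauTerm n (x ∷ y ∷ R)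
    own x y R rewrite ≡ᵇ-refl x | Bool.∧-identityʳ (x ≡ᵇ y) = refl

  ascentTerm-off-shape : ∀ {n x y c R} → x ∈ range n → y ∈ range n → ¬ (y ≡ suc x × c ≡ suc x) →
                         ascentTerm n (x ∷ y ∷ c ∷ R) ≡ 0ℤ
  ascentTerm-off-shape {n} {x} {y} {c} {R} x∈ y∈ off with x ≟ y
  ... | yes refl rewrite ≡ᵇ-refl x | Bool.∧-zeroʳ (inQ132 n (x ∷ x ∷ c ∷ R)) = refl
  ... | no x≢y rewrite ≡ᵇ-≢ x≢y | Bool.∧-identityʳ (inQ132 n (x ∷ y ∷ c ∷ R))
    with inQ132 n (x ∷ y ∷ c ∷ R) in σ∈Q
  ...   | false = refl
  ...   | true = ⊥-elim (off (ascent-shape {n} {x} {y} {c} {R} (Equivalence.from Bool.T-≡ σ∈Q) x≢y x∈ y∈))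

  ascentTerm-on-shape : ∀ n x R → ascentTerm n (x ∷ suc x ∷ suc x ∷ R) ≡ term n (x ∷ suc x ∷ suc x ∷ R)
  ascentTerm-on-shape n x R = cong (λ b → if b then weight p q r σ else 0ℤ)
    (trans (cong (λ b → inQ132 n σ ∧ not b) (≡ᵇ-≢ (ℕ.<⇒≢ (ℕ.n<1+n x)))) (Bool.∧-identityʳ (inQ132 n σ)))
    where σ = x ∷ suc x ∷ suc x ∷ R

  ascent-sum : ∀ m L → ⨁ (words (suc m) (3 ℕ.+ L)) (ascentTerm (suc m))
                     ≡ ⨁ (range m) (λ x → ⨁ (words (suc m) L) (λ R → term (suc m) (x ∷ suc x ∷ suc x ∷ R)))
  ascent-sum m L = begin
    ⨁ (words n (3 ℕ.+ L)) (ascentTerm n)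
      ≡⟨ trans (⨁-words-suc n (2 ℕ.+ L) _) (⨁-cong (range n) (λ x _ →
           trans (⨁-words-suc n (suc L) _) (⨁-cong (range n) (λ y _ → ⨁-words-suc n L _)))) ⟩
    ⨁ (range n) starting
      ≡⟨ cong (λ xs → ⨁ xs starting) (range-suc m) ⟩
    ⨁ (range m ++ n ∷ []) starting
      ≡⟨ ⨁-++ (range m) (n ∷ []) starting ⟩
    ⨁ (range m) starting + (starting n + 0ℤ)
      ≡⟨ cong₂ _+_ (⨁-cong (range m) starting-below) (cong (_+ 0ℤ) starting-top) ⟩
    ⨁ (range m) (λ x → ⨁ (words n L) (λ R → term n (x ∷ suc x ∷ suc x ∷ R))) + 0ℤ
      ≡⟨ ℤ.+-identityʳ _ ⟩
    ⨁ (range m) (λ x → ⨁ (words n L) (λ R → term n (x ∷ suc x ∷ suc x ∷ R))) ∎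
    where
    open ≡-Reasoning
    n = suc m
    starting : ℕ → ℤ
    starting x = ⨁ (range n) (λ y → ⨁ (range n) (λ c → ⨁ (words n L) (λ R → ascentTerm n (x ∷ y ∷ c ∷ R))))

    starting-top : starting n ≡ 0ℤ
    starting-top = ⨁-ε (range n) (λ y y∈ → ⨁-ε (range n) (λ c _ → ⨁-ε (words n L) (λ R _ →
      ascentTerm-off-shape {n} {n} {y} {c} {R} (∈-range⁺ n (s≤s z≤n) ℕ.≤-refl) y∈
        (λ (y≡1+n , _) → ℕ.<⇒≢ (s≤s (proj₂ (∈-range⁻ n y∈))) y≡1+n))))

    starting-below : ∀ x → x ∈ range m → starting x ≡ ⨁ (words n L) (λ R → term n (x ∷ suc x ∷ suc x ∷ R))
    starting-below x x∈ = begin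
      starting x
        ≡⟨ ⨁-range-single n _ 1+x∈ (λ y y∈ y≢ → ⨁-ε (range n) (λ c _ → ⨁-ε (words n L) (λ R _ →
             ascentTerm-off-shape {n} {x} {y} {c} {R} x∈n y∈ (y≢ ∘ proj₁)))) ⟩
      ⨁ (range n) (λ c → ⨁ (words n L) (λ R → ascentTerm n (x ∷ suc x ∷ c ∷ R)))
        ≡⟨ ⨁-range-single n _ 1+x∈ (λ c _ c≢ → ⨁-ε (words n L) (λ R _ →
             ascentTerm-off-shape {n} {x} {suc x} {c} {R} x∈n 1+x∈ (c≢ ∘ proj₂))) ⟩
      ⨁ (words n L) (λ R → ascentTerm n (x ∷ suc x ∷ suc x ∷ R))
        ≡⟨ ⨁-cong (words n L) (λ R _ → ascentTerm-on-shape n x R) ⟩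
      ⨁ (words n L) (λ R → term n (x ∷ suc x ∷ suc x ∷ R)) ∎
      where
      x∈n = ∈-range⁺ n (proj₁ (∈-range⁻ m x∈)) (ℕ.m≤n⇒m≤1+n (proj₂ (∈-range⁻ m x∈)))
      1+x∈ = ∈-range⁺ n (s≤s z≤n) (s≤s (proj₂ (∈-range⁻ m x∈)))

  relabel : ∀ m L a → a ≤ m →
            ⨁ (words (suc m) L) (λ R → term (suc m) (a ∷ suc a ∷ suc a ∷ R))
            ≡ r * ⨁ (words m L) (λ v → term m (a ∷ v) * plateauFactor p q (a ∷ v))
  relabel m L a a≤m = begin
    ⨁ (words (suc m) L) (λ R → term (suc m) (a ∷ suc a ∷ suc a ∷ R))
      ≡⟨ ⨁-words-punchIn m L _ (s≤s z≤n) (s≤s a≤m) repeated ⟩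
    ⨁ (words m L) (λ v → term (suc m) (a ∷ suc a ∷ suc a ∷ map (punchIn (suc a)) v))
      ≡⟨ ⨁-cong (words m L) (λ v _ → inserted v) ⟩
    ⨁ (words m L) (λ v → r * (term m (a ∷ v) * plateauFactor p q (a ∷ v)))
      ≡⟨ ⨁-homo (r *_) (ℤ.*-zeroʳ r) (ℤ.*-distribˡ-+ r) (words m L) _ ⟩
    r * ⨁ (words m L) (λ v → term m (a ∷ v) * plateauFactor p q (a ∷ v)) ∎
    where
    open ≡-Reasoning
    repeated : ∀ w → suc a ∈ w → term (suc m) (a ∷ suc a ∷ suc a ∷ w) ≡ 0ℤ
    repeated w 1+a∈w with inQ132 (suc m) (a ∷ suc a ∷ suc a ∷ w) in σ∈Q
    ... | false = refl
    ... | true = ⊥-elim (ℕ.<⇒≢ (s≤s (s≤s (∈⇒count-pos w 1+a∈w))) (begin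
      2                                          ≡⟨ sym (Q132.count-two {suc m} {a ∷ suc a ∷ suc a ∷ w} (Equivalence.from Bool.T-≡ σ∈Q) (∈-range⁺ (suc m) (s≤s z≤n) (s≤s a≤m))) ⟩
      count (suc a) (a ∷ suc a ∷ suc a ∷ w)      ≡⟨ count-∷-≢ (suc a ∷ suc a ∷ w) (ℕ.<⇒≢ (ℕ.n<1+n a)) ⟩
      count (suc a) (suc a ∷ suc a ∷ w)          ≡⟨ trans (count-∷-≡ (suc a) (suc a ∷ w)) (cong suc (count-∷-≡ (suc a) w)) ⟩
      suc (suc (count (suc a) w))                ∎))
    inserted : ∀ v → term (suc m) (a ∷ suc a ∷ suc a ∷ map (punchIn (suc a)) v)
                     ≡ r * (term m (a ∷ v) * plateauFactor p q (a ∷ v))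
    inserted v rewrite InsertPlateau.inQ132-insertPlateau {a} v a≤m with inQ132 m (a ∷ v)
    ... | true = InsertPlateau.weight-insertPlateau {a} v p q r
    ... | false = sym (trans (cong (r *_) (ℤ.*-zeroˡ (plateauFactor p q (a ∷ v)))) (ℤ.*-zeroʳ r))

  recurrence : ∀ m k →
    ⨁ (words (suc m) (4 ℕ.+ k)) (term (suc m))
      ≡ ⨁ (range (suc m)) (λ i → prefixSum (suc m) (4 ℕ.+ k) (i ∷ i ∷ []))
        + r * (p * ⨁ (words m (2 ℕ.+ k)) (term m) + (q - p) * ⨁ (range m) (λ i → prefixSum m (2 ℕ.+ k) (i ∷ i ∷ [])))
  recurrence m k = begin
    ⨁ W (term n)
      ≡⟨ trans (⨁-cong W (λ σ _ → term-split n σ)) (⨁-∙ W (plateauTerm n) (ascentTerm n)) ⟩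
    ⨁ W (plateauTerm n) + ⨁ W (ascentTerm n)
      ≡⟨ cong₂ _+_ (sym (plateau-sum n (2 ℕ.+ k))) ascents ⟩
    ⨁ (range n) (λ i → prefixSum n (4 ℕ.+ k) (i ∷ i ∷ [])) + r * (p * ⨁ Wₘ (term m) + (q - p) * Sₘ) ∎
    where
    open ≡-Reasoning
    n = suc m
    W = words n (4 ℕ.+ k)
    Wₘ = words m (2 ℕ.+ k)
    Sₘ = ⨁ (range m) (λ i → prefixSum m (2 ℕ.+ k) (i ∷ i ∷ []))
    ascents : ⨁ W (ascentTerm n) ≡ r * (p * ⨁ Wₘ (term m) + (q - p) * Sₘ)
    ascents = begin
      ⨁ W (ascentTerm n)
        ≡⟨ ascent-sum m (suc k) ⟩
      ⨁ (range m) (λ a → ⨁ (words n (suc k)) (λ R → term n (a ∷ suc a ∷ suc a ∷ R)))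
        ≡⟨ ⨁-cong (range m) (λ a a∈ → relabel m (suc k) a (proj₂ (∈-range⁻ m a∈))) ⟩
      ⨁ (range m) (λ a → r * ⨁ (words m (suc k)) (λ v → term m (a ∷ v) * plateauFactor p q (a ∷ v)))
        ≡⟨ ⨁-homo (r *_) (ℤ.*-zeroʳ r) (ℤ.*-distribˡ-+ r) (range m) _ ⟩
      r * ⨁ (range m) (λ a → ⨁ (words m (suc k)) (λ v → term m (a ∷ v) * plateauFactor p q (a ∷ v)))
        ≡⟨ cong (r *_) (sym (⨁-words-suc m (suc k) (λ w → term m w * plateauFactor p q w))) ⟩
      r * ⨁ Wₘ (λ w → term m w * plateauFactor p q w)
        ≡⟨ cong (r *_) (trans (⨁-cong Wₘ (λ w _ → term-plateauFactor m w)) (⨁-∙ Wₘ _ _)) ⟩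
      r * (⨁ Wₘ (λ w → p * term m w) + ⨁ Wₘ (λ w → (q - p) * plateauTerm m w))
        ≡⟨ cong (r *_) (cong₂ _+_ (⨁-homo (p *_) (ℤ.*-zeroʳ p) (ℤ.*-distribˡ-+ p) Wₘ (term m))
                                  (⨁-homo ((q - p) *_) (ℤ.*-zeroʳ (q - p)) (ℤ.*-distribˡ-+ (q - p)) Wₘ (plateauTerm m))) ⟩
      r * (p * ⨁ Wₘ (term m) + (q - p) * ⨁ Wₘ (plateauTerm m))
        ≡⟨ cong (λ t → r * (p * ⨁ Wₘ (term m) + (q - p) * t)) (sym (plateau-sum m k)) ⟩
      r * (p * ⨁ Wₘ (term m) + (q - p) * Sₘ) ∎

  g≡⨁term : ∀ n {ℓ} → 2 ℕ.* n ≡ ℓ → g p q r n ≡ ⨁ (words n ℓ) (term n)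
  g≡⨁term n refl = ⨁-cong (words n (2 ℕ.* n))
    (λ σ _ → cong (λ b → if b then weight p q r σ else 0ℤ) (Bool.∧-identityʳ (inQ132 n σ)))

  gPrefixSums≡ : ∀ n {ℓ} → 2 ℕ.* n ≡ ℓ →
    sumFrom1 n (λ i → gPre p q r n (i ∷ i ∷ [])) ≡ ⨁ (range n) (λ i → prefixSum n ℓ (i ∷ i ∷ []))
  gPrefixSums≡ n refl = refl

lemma2p7 : (n : ℕ) → 2 ≤ n → (p q r : ℤ) →
    g p q r n - p * r * g p q r (n ∸ 1)
      ≡ sumFrom1 n (λ i → gPre p q r n (i ∷ i ∷ []))
        + r * (q - p) * sumFrom1 (n ∸ 1) (λ i → gPre p q r (n ∸ 1) (i ∷ i ∷ []))
lemma2p7 (suc (suc k)) (s≤s (s≤s z≤n)) p q r = begin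
  g p q r n - p * r * g p q r m
    ≡⟨ cong₂ (λ a b → a - p * r * b) (trans (g≡⨁term n 2n≡) (recurrence m (2 ℕ.* k))) (g≡⨁term m 2m≡) ⟩
  (Sₙ + r * (p * Gₘ + (q - p) * Sₘ)) - p * r * Gₘ
    ≡⟨ cancel p q r Gₘ Sₙ Sₘ ⟩
  Sₙ + r * (q - p) * Sₘ
    ≡⟨ sym (cong₂ (λ a b → a + r * (q - p) * b) (gPrefixSums≡ n 2n≡) (gPrefixSums≡ m 2m≡)) ⟩
  sumFrom1 n (λ i → gPre p q r n (i ∷ i ∷ [])) + r * (q - p) * sumFrom1 m (λ i → gPre p q r m (i ∷ i ∷ [])) ∎
  where
  open ≡-Reasoning
  open Sums p q r
  m = suc k
  n = suc m
  2m≡ : 2 ℕ.* m ≡ 2 ℕ.+ 2 ℕ.* k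
  2m≡ = ℕ.*-suc 2 k
  2n≡ : 2 ℕ.* n ≡ 4 ℕ.+ 2 ℕ.* k
  2n≡ = trans (ℕ.*-suc 2 m) (cong (2 ℕ.+_) 2m≡)
  Gₘ = ⨁ (words m (2 ℕ.+ 2 ℕ.* k)) (term m)
  Sₙ = ⨁ (range n) (λ i → prefixSum n (4 ℕ.+ 2 ℕ.* k) (i ∷ i ∷ []))
  Sₘ = ⨁ (range m) (λ i → prefixSum m (2 ℕ.+ 2 ℕ.* k) (i ∷ i ∷ []))
  cancel : ∀ p q r G S S′ → (S + r * (p * G + (q - p) * S′)) - p * r * G ≡ S + r * (q - p) * S′
  cancel = solve-∀
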